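{- Let $S\subset\mathbb{N}$ with $|S|=4$. Maker has a $4$-move strategy in the game for $S$ if and only if $S$ is symmetric.
   Context: Game for $S$: for a fixed finite set $S\subset\mathbb{N}$, two players, Maker and Breaker, alternately choose previously unchosen natural numbers, Maker choosing first. Maker wins as soon as the set of Maker's choices contains $aS+b$ for some $a\in\mathbb{N}\setminus\{0\}$ and $b\in\mathbb{Z}$. Maker has an $N$-move strategy if Maker has a strategy guaranteeing a win using at most $N$ selections, whatever Breaker does. For $R,R'\subset\mathbb{Q}$, $R'$ is a copy of $R$ if $R'=aR+b$ for some rational $a>0$ and rational $b$. Writing $S=\{s_1<s_2<s_3<s_4\}$, $S$ is symmetric if there exist $1\le i<j\le 4$ such that $S\setminus\{s_i\}$ is a copy of $S\setminus\{s_j\}$. -}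

module Defs where

open import Data.Nat as ℕ using (ℕ; zero; suc; _<_)
open import Data.Integer as ℤ using (ℤ; +_)
open import Data.Rational as ℚ using (ℚ; _/_)
open import Data.List using (List; []; _∷_)
open import Data.List.Membership.Propositional using (_∈_; _∉_)
open import Data.Vec as Vec using (Vec; removeAt; toList)
open import Data.Fin using (Fin)
open import Data.Product using (Σ; ∃; _×_; _,_)
open import Data.Sum using (_⊎_)
open import Data.Empty using (⊥)
open import Relation.Binary.PropositionalEquality using (_≡_)

Contains : List ℕ → List ℕ → Set
Contains S M = Σ ℕ λ a → (0 < a) × Σ ℤ λ b →
  (∀ s → s ∈ S → Σ ℕ λ m → (m ∈ M) × ((+ a) ℤ.* (+ s) ℤ.+ b ≡ + m))

-- MakerWinsIn S n M B : it is Maker's turn, Maker has chosen M, Breaker has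
-- chosen B, and Maker can force a win using at most n further selections.
MakerWinsIn : List ℕ → ℕ → List ℕ → List ℕ → Set
MakerWinsIn S zero    M B = ⊥
MakerWinsIn S (suc n) M B = Σ ℕ λ x → (x ∉ M) × (x ∉ B) ×
  (Contains S (x ∷ M) ⊎
   (∀ y → y ∉ (x ∷ M) → y ∉ B → MakerWinsIn S n (x ∷ M) (y ∷ B)))

HasStrategy : ℕ → List ℕ → Set
HasStrategy N S = MakerWinsIn S N [] []

ℕtoℚ : ℕ → ℚ
ℕtoℚ n = (+ n) / 1

IsCopy : List ℕ → List ℕ → Set
IsCopy R' R = Σ ℚ λ a → ℚ.Positive a × Σ ℚ λ b →
  (∀ r → r ∈ R → Σ ℕ λ r' → (r' ∈ R') × (ℚtimes a r b ≡ ℕtoℚ r')) ×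
  (∀ r' → r' ∈ R' → Σ ℕ λ r → (r ∈ R) × (ℚtimes a r b ≡ ℕtoℚ r'))
  where
  ℚtimes : ℚ → ℕ → ℚ → ℚ
  ℚtimes a r b = a ℚ.* ℕtoℚ r ℚ.+ b

-- S = {s₁ < s₂ < s₃ < s₄} given as a vector (indices 0..3 for s₁..s₄).
-- S is symmetric if S∖{s_i} is a copy of S∖{s_j} for some i < j.
Symmetric : Vec ℕ 4 → Set
Symmetric v = Σ (Fin 4) λ i → Σ (Fin 4) λ j → (i Data.Fin.< j) ×
  IsCopy (toList (removeAt v i)) (toList (removeAt v j))

module Submission where

-- If Breaker always answers with a fresh number, Maker's fourth number p completes a
-- copy of S with his first three numbers T; had Breaker taken p, Maker would complete
-- another copy with some q ≠ p. Each copy places S minus one element onto T. Were the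
-- omitted elements the same, the two increasing affine maps would agree on the minimum
-- and maximum of T, hence everywhere, giving p = q; so they differ, and one map followed
-- by the inverse of the other carries S ∖ {s_j} onto S ∖ {s_i}.
--
-- Conversely, an increasing affine map preserves the ratio of consecutive gaps, so for a
-- symmetric S the gaps D₁, D₂, D₃ satisfy D₂² = D₁D₃, D₁D₃ = D₂² + D₂D₃ or
-- D₁D₃ = D₁D₂ + D₂². Each relation yields five integers x, z, w, c₁, c₂ such that
-- {c₁, w, z, x} and {c₂, w, z, x} contain copies of S. Dilating about x by w - x and by
-- z - x swaps the roles of z and w, giving two plans that share Maker's first two
-- numbers 0 and E = (w - x)(z - x). Maker plays these (suitably translated and scaled to
-- dodge Breaker's first answer), then the third number of a plan that Breaker's second
-- answer left untouched, and is left with two ways to complete S.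

open import Defs
open import Data.Nat using (ℕ; _<_)
open import Data.Vec using (Vec; _∷_; []; toList)
open import Function.Bundles using (_⇔_; mk⇔)

open import Data.Nat as ℕ using (zero; suc; z≤n; s≤s; _≤_)
import Data.Nat.Properties as ℕP
open import Data.Integer as ℤ using (ℤ; +_; 0ℤ; ∣_∣; _+_; _-_; _*_; -_)
import Data.Integer.Properties as ℤP
open import Algebra.Bundles using (AbelianGroup)
open import Algebra.Properties.Group (AbelianGroup.group ℤP.+-0-abelianGroup) using () renaming (∙-cancelˡ to +-cancelˡ; ∙-cancelʳ to +-cancelʳ)
open import Data.Integer.Tactic.RingSolver using (solve-∀)
open import Data.Rational as ℚ using (ℚ; mkℚ; toℚᵘ; _/_)
import Data.Rational.Properties as ℚP
open import Data.Rational.Unnormalised as ℚᵘ using (mkℚᵘ; *≡*)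
import Data.Rational.Unnormalised.Properties as ℚᵘP
open import Data.Fin as Fin using (Fin; zero; suc; punchIn)
import Data.Fin.Properties as FinP
open import Data.Vec using (lookup; removeAt)
import Data.Vec.Properties as VecP
open import Data.Vec.Membership.Propositional.Properties using (∈-lookup; ∈-toList⁺; ∈-toList⁻)
import Data.Vec.Relation.Unary.Any as VecAny
import Data.Vec.Relation.Unary.Any.Properties as VecAnyP
open import Data.List as List using (List; []; _∷_; _++_; length)
open import Data.Nat.ListAction using (sum)
open import Data.List.Membership.Propositional using (_∈_; _∉_; find; lose)
open import Data.List.Membership.Propositional.Properties using (∈-++⁺ˡ; ∈-++⁺ʳ; ∈-map⁺; ∈-map⁻)
open import Data.List.Relation.Unary.All as All using (All; []; _∷_)
open import Data.List.Relation.Unary.AllPairs as AllPairs using ([]; _∷_)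
import Data.List.Relation.Unary.AllPairs.Properties as AllPairsP
open import Data.List.Relation.Unary.Unique.Propositional using (Unique)
open import Data.List.Relation.Unary.Any as ListAny using (here; there; index)
import Data.List.Relation.Unary.Any.Properties as ListAnyP
open import Data.Product using (Σ; ∃; _×_; _,_; proj₁; proj₂)
open import Data.Sum using (inj₁; inj₂)
open import Data.Empty using (⊥; ⊥-elim)
open import Function using (_∘_)
open import Function.Definitions using (Injective)
open import Relation.Nullary using (yes; no)
open import Relation.Binary.Definitions using (DecidableEquality; tri<; tri≈; tri>)
open import Relation.Binary.PropositionalEquality

private variable
  n : ℕ

module _ {A : Set} where

  ∈-index-injective : ∀ {x y : A} {xs} (p : x ∈ xs) (q : y ∈ xs) → index p ≡ index q → x ≡ y
  ∈-index-injective {xs = xs} p q eq = begin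
    _                            ≡⟨ ListAnyP.lookup-index p ⟩
    List.lookup xs (index p)     ≡⟨ cong (List.lookup xs) eq ⟩
    List.lookup xs (index q)     ≡⟨ sym (ListAnyP.lookup-index q) ⟩
    _                            ∎
    where open ≡-Reasoning

  injection-into-shorter : (f : Fin n → A) → Injective _≡_ _≡_ f → ∀ {xs} →
                           (∀ k → f k ∈ xs) → length xs < n → ⊥
  injection-into-shorter f f-inj f∈ short with FinP.pigeonhole short (λ k → index (f∈ k))
  ... | i , j , i<j , same = FinP.<⇒≢ i<j (f-inj (∈-index-injective (f∈ i) (f∈ j) same))

  injection-onto : ∀ {n} → DecidableEquality A → (f : Fin n → A) → Injective _≡_ _≡_ f → ∀ {xs} →
                   (∀ k → f k ∈ xs) → length xs ≤ n → ∀ {y} → y ∈ xs → ∃ λ k → f k ≡ y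
  injection-onto {n} _≟_ f f-inj {xs} f∈ short {y} y∈ with FinP.any? (λ k → f k ≟ y)
  ... | yes hit = hit
  ... | no miss = ⊥-elim (injection-into-shorter g g-inj g∈ (s≤s short))
    where
    g : Fin (suc n) → A
    g zero    = y
    g (suc k) = f k
    g-inj : Injective _≡_ _≡_ g
    g-inj {zero}  {zero}  _  = refl
    g-inj {zero}  {suc l} eq = ⊥-elim (miss (l , sym eq))
    g-inj {suc k} {zero}  eq = ⊥-elim (miss (k , eq))
    g-inj {suc k} {suc l} eq = cong suc (f-inj eq)
    g∈ : ∀ k → g k ∈ xs
    g∈ zero    = y∈
    g∈ (suc k) = f∈ k

∉-∷ : ∀ {A : Set} {x a : A} {xs} → x ≢ a → x ∉ xs → x ∉ a ∷ xs
∉-∷ x≢a x∉xs (here x≡a)  = x≢a x≡a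
∉-∷ x≢a x∉xs (there x∈xs) = x∉xs x∈xs

∉[] : ∀ {A : Set} {x : A} → x ∉ []
∉[] ()

∃-fresh : (xs : List ℕ) → ∃ λ y → y ∉ xs
∃-fresh xs = suc (sum xs) , λ y∈ → ℕP.<-irrefl refl (s≤s (∈⇒≤sum y∈))
  where
  ∈⇒≤sum : ∀ {y xs} → y ∈ xs → y ≤ sum xs
  ∈⇒≤sum {xs = x ∷ xs} (here refl) = ℕP.m≤m+n x (sum xs)
  ∈⇒≤sum {xs = x ∷ xs} (there y∈) = ℕP.≤-trans (∈⇒≤sum y∈) (ℕP.m≤n+m (sum xs) x)

∃-fresh₂ : (xs ys : List ℕ) → ∃ λ y → y ∉ xs × y ∉ ys
∃-fresh₂ xs ys with ∃-fresh (xs ++ ys)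
... | y , y∉ = y , (y∉ ∘ ∈-++⁺ˡ) , (y∉ ∘ ∈-++⁺ʳ xs)

lookup-removeAt : ∀ {A : Set} (xs : Vec A (suc n)) i k → lookup (removeAt xs i) k ≡ lookup xs (punchIn i k)
lookup-removeAt xs i k = begin
  lookup (removeAt xs i) k                         ≡⟨ cong (lookup (removeAt xs i)) (sym (FinP.punchOut-punchIn i)) ⟩
  lookup (removeAt xs i) (Fin.punchOut i≢punchIn)  ≡⟨ VecP.removeAt-punchOut xs i≢punchIn ⟩
  lookup xs (punchIn i k)                          ∎
  where
  open ≡-Reasoning
  i≢punchIn = FinP.punchInᵢ≢i i k ∘ sym

∈-removeAt⁺ : ∀ {A : Set} (xs : Vec A (suc n)) i k → lookup xs (punchIn i k) ∈ toList (removeAt xs i)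
∈-removeAt⁺ xs i k = subst (_∈ _) (lookup-removeAt xs i k) (∈-toList⁺ (∈-lookup k (removeAt xs i)))

∈-removeAt⁻ : ∀ {A : Set} (xs : Vec A (suc n)) i {x} → x ∈ toList (removeAt xs i) →
              ∃ λ k → x ≡ lookup xs (punchIn i k)
∈-removeAt⁻ xs i x∈ = let p = ∈-toList⁻ x∈ in
  VecAny.index p , trans (VecAnyP.lookup-index p) (lookup-removeAt xs i _)

affine-strictMono : ∀ a b {r r'} → 0 < a → r < r' → + a * + r + b ℤ.< + a * + r' + b
affine-strictMono (suc a) b _ r<r' = ℤP.+-monoˡ-< b (ℤP.*-monoˡ-<-pos (+ suc a) (ℤ.+<+ r<r'))

affine-unique : ∀ a₁ b₁ a₂ b₂ {r r'} → r ≢ r' →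
                + a₁ * + r  + b₁ ≡ + a₂ * + r  + b₂ →
                + a₁ * + r' + b₁ ≡ + a₂ * + r' + b₂ →
                ∀ r'' → + a₁ * + r'' + b₁ ≡ + a₂ * + r'' + b₂
affine-unique a₁ b₁ a₂ b₂ {r} {r'} r≢r' at-r at-r' r'' with ℤP.i*j≡0⇒i≡0∨j≡0 (+ a₁ - + a₂) slope-gap
  where
  slope-gap : (+ a₁ - + a₂) * (+ r' - + r) ≡ 0ℤ
  slope-gap = begin
    (+ a₁ - + a₂) * (+ r' - + r)                                            ≡⟨ expand (+ a₁) b₁ (+ a₂) b₂ (+ r) (+ r') ⟩
    ((+ a₁ * + r' + b₁) - (+ a₂ * + r' + b₂)) - ((+ a₁ * + r + b₁) - (+ a₂ * + r + b₂))
      ≡⟨ cong₂ _-_ (ℤP.i≡j⇒i-j≡0 at-r') (ℤP.i≡j⇒i-j≡0 at-r) ⟩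
    0ℤ                                                                      ∎
    where
    open ≡-Reasoning
    expand : ∀ a₁ b₁ a₂ b₂ r r' → (a₁ - a₂) * (r' - r) ≡ ((a₁ * r' + b₁) - (a₂ * r' + b₂)) - ((a₁ * r + b₁) - (a₂ * r + b₂))
    expand = solve-∀
... | inj₂ r'≡r = ⊥-elim (r≢r' (sym (ℤP.+-injective (ℤP.i-j≡0⇒i≡j _ _ r'≡r))))
... | inj₁ a₁-a₂≡0 with ℤP.+-injective {a₁} {a₂} (ℤP.i-j≡0⇒i≡j _ _ a₁-a₂≡0)
...   | refl = cong (λ t → + a₂ * + r'' + t) (+-cancelˡ (+ a₂ * + r) b₁ b₂ at-r)

ℕtoℚ-toℚᵘ : ∀ r → toℚᵘ (ℕtoℚ r) ℚᵘ.≃ mkℚᵘ (+ r) 0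
ℕtoℚ-toℚᵘ r = ℚP.toℚᵘ-fromℚᵘ (mkℚᵘ (+ r) 0)

affine-ℤ⇒ℚ : ∀ A n B r r' → + A * + r + B ≡ + r' * + suc n →
             ((+ A) / suc n) ℚ.* ℕtoℚ r ℚ.+ B / suc n ≡ ℕtoℚ r'
affine-ℤ⇒ℚ A n B r r' eq = ℚP.toℚᵘ-injective in-ℚᵘ
  where
  a = (+ A) / suc n
  b = B / suc n
  N = + suc n

  cross-multiplied : ((+ A * + r) * N + B * + suc (n ℕ.* 1)) * + 1 ≡ + r' * + (suc (n ℕ.* 1) ℕ.* suc n)
  cross-multiplied rewrite ℕP.*-identityʳ n | ℤP.pos-* (suc n) (suc n) = begin
    ((+ A * + r) * N + B * N) * + 1  ≡⟨ factor (+ A * + r) B N ⟩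
    (+ A * + r + B) * N              ≡⟨ cong (_* N) eq ⟩
    (+ r' * N) * N                   ≡⟨ ℤP.*-assoc (+ r') N N ⟩
    + r' * (N * N)                   ∎
    where
    open ≡-Reasoning
    factor : ∀ x y z → (x * z + y * z) * + 1 ≡ (x + y) * z
    factor = solve-∀

  in-ℚᵘ : toℚᵘ (a ℚ.* ℕtoℚ r ℚ.+ b) ℚᵘ.≃ toℚᵘ (ℕtoℚ r')
  in-ℚᵘ = begin
    toℚᵘ (a ℚ.* ℕtoℚ r ℚ.+ b)                     ≈⟨ ℚP.toℚᵘ-homo-+ (a ℚ.* ℕtoℚ r) b ⟩
    toℚᵘ (a ℚ.* ℕtoℚ r) ℚᵘ.+ toℚᵘ b              ≈⟨ ℚᵘP.+-cong (ℚᵘP.≃-trans (ℚP.toℚᵘ-homo-* a (ℕtoℚ r))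
                                                        (ℚᵘP.*-cong (ℚP.toℚᵘ-fromℚᵘ (mkℚᵘ (+ A) n)) (ℕtoℚ-toℚᵘ r)))
                                                      (ℚP.toℚᵘ-fromℚᵘ (mkℚᵘ B n)) ⟩
    mkℚᵘ (+ A) n ℚᵘ.* mkℚᵘ (+ r) 0 ℚᵘ.+ mkℚᵘ B n  ≈⟨ *≡* cross-multiplied ⟩
    mkℚᵘ (+ r') 0                                 ≈⟨ ℚᵘP.≃-sym (ℕtoℚ-toℚᵘ r') ⟩
    toℚᵘ (ℕtoℚ r')                                ∎
    where open ℚᵘP.≃-Reasoning

ℚ-affine⇒ℤ : ∀ (a b : ℚ) r r' → a ℚ.* ℕtoℚ r ℚ.+ b ≡ ℕtoℚ r' →
             ℚ.↥ a * + r * ℚ.↧ b + ℚ.↥ b * ℚ.↧ a ≡ + r' * (ℚ.↧ a * ℚ.↧ b)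
ℚ-affine⇒ℤ a@(mkℚ A da _) b@(mkℚ B db _) r r' eq = begin
  A * + r * + suc db + B * + suc da                ≡⟨ cong (λ d → A * + r * + suc db + B * + d) (sym (ℕP.*-identityʳ (suc da))) ⟩
  A * + r * + suc db + B * + (suc da ℕ.* 1)        ≡⟨ sym (ℤP.*-identityʳ _) ⟩
  (A * + r * + suc db + B * + (suc da ℕ.* 1)) * + 1 ≡⟨ cross-multiplied ⟩
  + r' * + (suc da ℕ.* 1 ℕ.* suc db)               ≡⟨ cong (λ d → + r' * + (d ℕ.* suc db)) (ℕP.*-identityʳ (suc da)) ⟩
  + r' * + (suc da ℕ.* suc db)                     ≡⟨ cong (+ r' *_) (ℤP.pos-* (suc da) (suc db)) ⟩
  + r' * (+ suc da * + suc db)                     ∎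
  where
  open ≡-Reasoning
  in-ℚᵘ : mkℚᵘ A da ℚᵘ.* mkℚᵘ (+ r) 0 ℚᵘ.+ mkℚᵘ B db ℚᵘ.≃ mkℚᵘ (+ r') 0
  in-ℚᵘ = ℚᵘP.≃-trans (ℚᵘP.≃-sym (ℚᵘP.≃-trans (ℚP.toℚᵘ-homo-+ (a ℚ.* ℕtoℚ r) b)
            (ℚᵘP.+-congˡ (mkℚᵘ B db) (ℚᵘP.≃-trans (ℚP.toℚᵘ-homo-* a (ℕtoℚ r)) (ℚᵘP.*-congˡ {mkℚᵘ A da} (ℕtoℚ-toℚᵘ r))))))
          (ℚᵘP.≃-trans (ℚP.toℚᵘ-cong eq) (ℕtoℚ-toℚᵘ r'))
  cross-multiplied : (A * + r * + suc db + B * + (suc da ℕ.* 1)) * + 1 ≡ + r' * + (suc da ℕ.* 1 ℕ.* suc db)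
  cross-multiplied with in-ℚᵘ
  ... | *≡* e = e

-- Breaker's strategy: always answer with a fresh number

record TwoCompletions (S T : List ℕ) : Set where
  field
    {p q}  : ℕ
    p∉T    : p ∉ T
    q∉T    : q ∉ T
    p≢q    : p ≢ q
    with-p : Contains S (p ∷ T)
    with-q : Contains S (q ∷ T)

module FreshBreaker (S : List ℕ) where

  no-moves-left : ∀ {M B} → (∀ y → y ∉ M → y ∉ B → MakerWinsIn S 0 M (y ∷ B)) → ⊥
  no-moves-left {M} {B} next with ∃-fresh₂ M B
  ... | y , y∉M , y∉B = next y y∉M y∉B

  -- Breaker answers Maker's last-but-one move with a fresh number, and then, in a
  -- second play, with the number Maker completed S with.
  last-reply : ∀ {T B} → (∀ y → y ∉ T → y ∉ B → MakerWinsIn S 1 T (y ∷ B)) → TwoCompletions S T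
  last-reply {T} {B} next with ∃-fresh₂ T B
  ... | d , d∉T , d∉B with next d d∉T d∉B
  ...   | _ , _ , _ , inj₂ next' = ⊥-elim (no-moves-left next')
  ...   | p , p∉T , p∉d∷B , inj₁ with-p with next p p∉T (p∉d∷B ∘ there)
  ...     | _ , _ , _ , inj₂ next' = ⊥-elim (no-moves-left next')
  ...     | q , q∉T , q∉p∷B , inj₁ with-q = record
    { p∉T = p∉T ; q∉T = q∉T ; p≢q = q∉p∷B ∘ here ∘ sym ; with-p = with-p ; with-q = with-q }

  module _ {n} (no-early-win : ∀ {M} → Contains S M → length M ≤ n → ⊥) where

    two-completions : ∀ k {M B} → suc k ℕ.+ length M ≡ n → MakerWinsIn S (2 ℕ.+ k) M B →
                      ∃ λ T → length T ≡ n × TwoCompletions S T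
    two-completions k {M} len (x , _ , _ , inj₁ win) =
      ⊥-elim (no-early-win win (subst (suc (length M) ≤_) len (ℕP.+-monoˡ-≤ (length M) (s≤s z≤n))))
    two-completions zero {M} len (x , _ , _ , inj₂ next) = x ∷ M , len , last-reply next
    two-completions (suc k) {M} {B} len (x , _ , _ , inj₂ next) with ∃-fresh₂ (x ∷ M) B
    ... | y , y∉ , y∉B = two-completions k (trans (ℕP.+-suc (suc k) (length M)) len) (next y y∉ y∉B)

module Placements (v : Vec ℕ n) (v-increasing : ∀ {k l} → k Fin.< l → lookup v k < lookup v l) where

  record Placement (M : List ℕ) : Set where
    field
      scale     : ℕ
      scale>0   : 0 < scale
      shift     : ℤ
      image     : Fin n → ℕ
      image∈    : ∀ k → image k ∈ M
      image-def : ∀ k → + scale * + lookup v k + shift ≡ + image k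

  open Placement public

  placement : ∀ {M} → Contains (toList v) M → Placement M
  placement (a , a>0 , b , occurs) = record
    { scale = a ; scale>0 = a>0 ; shift = b
    ; image     = λ k → proj₁ (occurs (lookup v k) (v∋ k))
    ; image∈    = λ k → proj₁ (proj₂ (occurs (lookup v k) (v∋ k)))
    ; image-def = λ k → proj₂ (proj₂ (occurs (lookup v k) (v∋ k)))
    }
    where
    v∋ : ∀ k → lookup v k ∈ toList v
    v∋ k = ∈-toList⁺ (∈-lookup k v)

  module _ {M} (P : Placement M) where

    image-strictMono : ∀ {k l} → k Fin.< l → image P k < image P l
    image-strictMono k<l = ℤP.drop‿+<+ (subst₂ ℤ._<_ (image-def P _) (image-def P _)
      (affine-strictMono (scale P) (shift P) (scale>0 P) (v-increasing k<l)))

    image-mono : ∀ {k l} → k Fin.≤ l → image P k ≤ image P l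
    image-mono {k} {l} k≤l with k FinP.≟ l
    ... | yes refl = ℕP.≤-refl
    ... | no k≢l   = ℕP.<⇒≤ (image-strictMono (FinP.≤∧≢⇒< k≤l k≢l))

    image-injective : Injective _≡_ _≡_ (image P)
    image-injective {k} {l} eq with FinP.<-cmp k l
    ... | tri< k<l _ _ = ⊥-elim (ℕP.<⇒≢ (image-strictMono k<l) eq)
    ... | tri≈ _ k≡l _ = k≡l
    ... | tri> _ _ l<k = ⊥-elim (ℕP.<⇒≢ (image-strictMono l<k) (sym eq))

    placement-needs-room : length M < n → ⊥
    placement-needs-room = injection-into-shorter (image P) image-injective (image∈ P)

module Completions {m} (v : Vec ℕ (3 ℕ.+ m)) (v-increasing : ∀ {k l} → k Fin.< l → lookup v k < lookup v l)
                   {T : List ℕ} (T-short : length T ≤ 2 ℕ.+ m) where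

  open Placements v v-increasing

  missing : ∀ {x} (P : Placement (x ∷ T)) → ∃ λ i → image P i ≡ x
  missing P = injection-onto ℕP._≟_ (image P) (image-injective P) (image∈ P) (s≤s T-short) (here refl)

  module Completion {x} (x∉T : x ∉ T) (P : Placement (x ∷ T)) (gap : Fin (3 ℕ.+ m)) (gap↦x : image P gap ≡ x) where

    rest : Fin (2 ℕ.+ m) → ℕ
    rest k = image P (punchIn gap k)

    rest∈T : ∀ k → rest k ∈ T
    rest∈T k with image∈ P (punchIn gap k)
    ... | here rest≡x = ⊥-elim (FinP.punchInᵢ≢i gap k (image-injective P (trans rest≡x (sym gap↦x))))
    ... | there t∈T   = t∈T

    rest-onto : ∀ {t} → t ∈ T → ∃ λ l → rest l ≡ t
    rest-onto = injection-onto ℕP._≟_ rest (FinP.punchIn-injective gap _ _ ∘ image-injective P) rest∈T T-short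

    rest-mono : ∀ {k l} → k Fin.≤ l → rest k ≤ rest l
    rest-mono = image-mono P ∘ FinP.punchIn-mono-≤ gap _ _

  module _ {p q} (p∉T : p ∉ T) (q∉T : q ∉ T) (P₁ : Placement (p ∷ T)) (P₂ : Placement (q ∷ T)) where

    -- Both placements fill T increasingly, so they agree on its minimum and maximum,
    -- hence everywhere.
    same-gap⇒same-completion : ∀ gap → image P₁ gap ≡ p → image P₂ gap ≡ q → p ≡ q
    same-gap⇒same-completion gap gap↦p gap↦q = begin
      p                      ≡⟨ sym gap↦p ⟩
      image P₁ gap           ≡⟨ ℤP.+-injective (trans (sym (image-def P₁ gap)) (trans (affine-agree (lookup v gap)) (image-def P₂ gap))) ⟩
      image P₂ gap           ≡⟨ gap↦q ⟩
      q                      ∎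
      where
      open ≡-Reasoning
      module C₁ = Completion p∉T P₁ gap gap↦p
      module C₂ = Completion q∉T P₂ gap gap↦q

      agree-at-extremum : (_≼_ : ℕ → ℕ → Set) → (∀ {a b} → a ≼ b → b ≼ a → a ≡ b) → ∀ k →
                          (∀ l → C₁.rest k ≼ C₁.rest l) → (∀ l → C₂.rest k ≼ C₂.rest l) → C₁.rest k ≡ C₂.rest k
      agree-at-extremum _≼_ antisym k extreme₁ extreme₂
        with C₁.rest-onto (C₂.rest∈T k) | C₂.rest-onto (C₁.rest∈T k)
      ... | l , rest₁≡ | l' , rest₂≡ = antisym (subst (C₁.rest k ≼_) rest₁≡ (extreme₁ l))
                                              (subst (C₂.rest k ≼_) rest₂≡ (extreme₂ l'))

      lowest highest : Fin (2 ℕ.+ m)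
      lowest  = zero
      highest = Fin.fromℕ (suc m)

      agree-lowest : C₁.rest lowest ≡ C₂.rest lowest
      agree-lowest = agree-at-extremum _≤_ ℕP.≤-antisym lowest
        (λ _ → C₁.rest-mono z≤n) (λ _ → C₂.rest-mono z≤n)

      agree-highest : C₁.rest highest ≡ C₂.rest highest
      agree-highest = agree-at-extremum (λ a b → b ≤ a) (λ b≤a a≤b → ℕP.≤-antisym a≤b b≤a) highest
        (λ l → C₁.rest-mono (FinP.≤fromℕ l)) (λ l → C₂.rest-mono (FinP.≤fromℕ l))

      agree-on : ∀ k → C₁.rest k ≡ C₂.rest k →
                 + scale P₁ * + lookup v (punchIn gap k) + shift P₁ ≡ + scale P₂ * + lookup v (punchIn gap k) + shift P₂
      agree-on k eq = trans (image-def P₁ _) (trans (cong +_ eq) (sym (image-def P₂ _)))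

      lowest≢highest : lookup v (punchIn gap lowest) ≢ lookup v (punchIn gap highest)
      lowest≢highest eq with FinP.punchIn-injective gap lowest highest (image-injective P₁ (ℤP.+-injective
        (trans (sym (image-def P₁ _)) (trans (cong (λ s → + scale P₁ * + s + shift P₁) eq) (image-def P₁ _)))))
      ... | ()

      affine-agree : ∀ r → + scale P₁ * + r + shift P₁ ≡ + scale P₂ * + r + shift P₂
      affine-agree = affine-unique (scale P₁) (shift P₁) (scale P₂) (shift P₂) lowest≢highest
        (agree-on lowest agree-lowest) (agree-on highest agree-highest)

    -- S \ {s_j} is carried onto S \ {s_i} by the inverse of P₁ after P₂.
    different-gaps⇒copy : ∀ i j → image P₁ i ≡ p → image P₂ j ≡ q →
                          IsCopy (toList (removeAt v i)) (toList (removeAt v j))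
    different-gaps⇒copy i j i↦p j↦q
      with scale P₁ | scale>0 P₁ | image-def P₁ | scale P₂ | scale>0 P₂ | image-def P₂
    ... | zero   | () | _    | _      | _  | _
    ... | suc _  | _  | _    | zero   | () | _
    ... | suc n₁ | _  | def₁ | suc n₂ | _  | def₂ = ratio , ℚP.normalize-pos (suc n₂) (suc n₁) , offset , forth , back
      where
      module C₁ = Completion p∉T P₁ i i↦p
      module C₂ = Completion q∉T P₂ j j↦q

      ratio offset : ℚ
      ratio  = + suc n₂ / suc n₁
      offset = (shift P₂ - shift P₁) / suc n₁

      transfer : ∀ {k l} → C₁.rest l ≡ C₂.rest k →
                 ratio ℚ.* ℕtoℚ (lookup v (punchIn j k)) ℚ.+ offset ≡ ℕtoℚ (lookup v (punchIn i l))
      transfer {k} {l} eq = affine-ℤ⇒ℚ (suc n₂) n₁ (shift P₂ - shift P₁) (lookup v (punchIn j k)) (lookup v (punchIn i l)) (begin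
        + suc n₂ * r + (shift P₂ - shift P₁)     ≡⟨ move (+ suc n₂ * r) (shift P₂) (shift P₁) ⟩
        (+ suc n₂ * r + shift P₂) - shift P₁     ≡⟨ cong (_- shift P₁) (trans (def₂ _) (cong +_ (sym eq))) ⟩
        + C₁.rest l - shift P₁                   ≡⟨ cong (_- shift P₁) (sym (def₁ _)) ⟩
        (+ suc n₁ * r' + shift P₁) - shift P₁    ≡⟨ cancel (+ suc n₁) r' (shift P₁) ⟩
        r' * + suc n₁                            ∎)
        where
        open ≡-Reasoning
        r  = + lookup v (punchIn j k)
        r' = + lookup v (punchIn i l)
        move : ∀ x y z → x + (y - z) ≡ (x + y) - z
        move = solve-∀
        cancel : ∀ a r z → (a * r + z) - z ≡ r * a
        cancel = solve-∀

      forth : ∀ r → r ∈ toList (removeAt v j) → Σ ℕ λ r' → (r' ∈ toList (removeAt v i)) ×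
              (ratio ℚ.* ℕtoℚ r ℚ.+ offset ≡ ℕtoℚ r')
      forth r r∈ with ∈-removeAt⁻ v j r∈
      ... | k , refl with C₁.rest-onto (C₂.rest∈T k)
      ...   | l , eq = lookup v (punchIn i l) , ∈-removeAt⁺ v i l , transfer eq

      back : ∀ r' → r' ∈ toList (removeAt v i) → Σ ℕ λ r → (r ∈ toList (removeAt v j)) ×
             (ratio ℚ.* ℕtoℚ r ℚ.+ offset ≡ ℕtoℚ r')
      back r' r'∈ with ∈-removeAt⁻ v i r'∈
      ... | l , refl with C₂.rest-onto (C₁.rest∈T l)
      ...   | k , eq = lookup v (punchIn j k) , ∈-removeAt⁺ v j k , transfer (sym eq)

  two-completions⇒copy : TwoCompletions (toList v) T →
                         ∃ λ i → ∃ λ j → i Fin.< j × IsCopy (toList (removeAt v i)) (toList (removeAt v j))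
  two-completions⇒copy record { p∉T = p∉T ; q∉T = q∉T ; p≢q = p≢q ; with-p = with-p ; with-q = with-q }
    with placement with-p | placement with-q
  ... | P₁ | P₂ with missing P₁ | missing P₂
  ...   | i , i↦p | j , j↦q with FinP.<-cmp i j
  ...     | tri< i<j _ _  = i , j , i<j , different-gaps⇒copy p∉T q∉T P₁ P₂ i j i↦p j↦q
  ...     | tri≈ _ refl _ = ⊥-elim (p≢q (same-gap⇒same-completion p∉T q∉T P₁ P₂ i i↦p j↦q))
  ...     | tri> _ _ j<i  = j , i , j<i , different-gaps⇒copy q∉T p∉T P₂ P₁ j i j↦q i↦p

module _ (v : Vec ℕ 4) (v-increasing : ∀ {k l} → k Fin.< l → lookup v k < lookup v l) where

  open Placements v v-increasing using (placement; placement-needs-room)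

  no-win-with-three : ∀ {M} → Contains (toList v) M → length M ≤ 3 → ⊥
  no-win-with-three win short = placement-needs-room (placement win) (s≤s short)

  makerWins⇒symmetric : HasStrategy 4 (toList v) → Symmetric v
  makerWins⇒symmetric strategy with FreshBreaker.two-completions (toList v) no-win-with-three 2 refl strategy
  ... | T , |T|≡3 , completions =
    Completions.two-completions⇒copy v v-increasing (ℕP.≤-reflexive |T|≡3) completions

increasing₄ : ∀ {s₁ s₂ s₃ s₄} → s₁ < s₂ → s₂ < s₃ → s₃ < s₄ →
              ∀ {k l} → k Fin.< l → lookup (s₁ ∷ s₂ ∷ s₃ ∷ s₄ ∷ []) k < lookup (s₁ ∷ s₂ ∷ s₃ ∷ s₄ ∷ []) l
increasing₄ a b c {zero}             {suc zero}             _ = a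
increasing₄ a b c {zero}             {suc (suc zero)}       _ = ℕP.<-trans a b
increasing₄ a b c {zero}             {suc (suc (suc zero))} _ = ℕP.<-trans a (ℕP.<-trans b c)
increasing₄ a b c {suc zero}         {suc (suc zero)}       _ = b
increasing₄ a b c {suc zero}         {suc (suc (suc zero))} _ = ℕP.<-trans b c
increasing₄ a b c {suc (suc zero)}   {suc (suc (suc zero))} _ = c
increasing₄ a b c {_}                {zero}                 ()
increasing₄ a b c {suc _}            {suc zero}             (s≤s ())
increasing₄ a b c {suc (suc _)}      {suc (suc zero)}       (s≤s (s≤s ()))
increasing₄ a b c {suc (suc (suc _))} {suc (suc (suc zero))} (s≤s (s≤s (s≤s ())))

-- Maker's strategy

record Copy (S : List ℕ) (L : List ℤ) : Set where
  field
    α    : ℕ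
    α>0  : 0 < α
    β    : ℤ
    maps : ∀ s → s ∈ S → + α * + s + β ∈ L

-- Maker holds 0 and E; the move `third` threatens to complete S with either `last₁` or `last₂`.
record Plan (S : List ℕ) (E : ℤ) : Set where
  field
    third last₁ last₂ : ℤ
    copy₁             : Copy S (last₁ ∷ third ∷ E ∷ 0ℤ ∷ [])
    copy₂             : Copy S (last₂ ∷ third ∷ E ∷ 0ℤ ∷ [])
    E≢0               : E ≢ 0ℤ
    third≢0           : third ≢ 0ℤ
    third≢E           : third ≢ E
    last₁≢0           : last₁ ≢ 0ℤ
    last₁≢E           : last₁ ≢ E
    last₁≢third       : last₁ ≢ third
    last₂≢0           : last₂ ≢ 0ℤ
    last₂≢E           : last₂ ≢ E
    last₂≢third       : last₂ ≢ third
    last₁≢last₂       : last₁ ≢ last₂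

  pending : List ℤ
  pending = third ∷ last₁ ∷ last₂ ∷ []

open Copy
open Plan

∣∣-sum : List ℤ → ℕ
∣∣-sum []       = 0
∣∣-sum (e ∷ es) = ∣ e ∣ ℕ.+ ∣∣-sum es

∈⇒∣∣≤∣∣-sum : ∀ {e es} → e ∈ es → ∣ e ∣ ≤ ∣∣-sum es
∈⇒∣∣≤∣∣-sum {es = x ∷ es} (here refl) = ℕP.m≤m+n _ _
∈⇒∣∣≤∣∣-sum {es = x ∷ es} (there e∈) = ℕP.≤-trans (∈⇒∣∣≤∣∣-sum e∈) (ℕP.m≤n+m _ _)

0≤+X+h*e : ∀ X h e → h ℕ.* ∣ e ∣ ≤ X → 0ℤ ℤ.≤ + X + + h * e
0≤+X+h*e X h (+ n) _ rewrite sym (ℤP.pos-* h n) | sym (ℤP.pos-+ X (h ℕ.* n)) = ℤ.+≤+ z≤n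
0≤+X+h*e X h ℤ.-[1+ n ] h|e|≤X =
  subst (0ℤ ℤ.≤_) (cong (λ z → + X + z) (trans (cong -_ (ℤP.pos-* h (suc n))) (ℤP.neg-distribʳ-* (+ h) (+ suc n))))
    (ℤP.i≤j⇒0≤j-i (ℤ.+≤+ h|e|≤X))

module Strategy {S : List ℕ} {E : ℤ} (P Q : Plan S E) (disjoint : ∀ {u} → u ∈ pending P → u ∉ pending Q) where

  relevant : List ℤ
  relevant = E ∷ pending P ++ pending Q

  -- Maker's numbers are X + h e, for a scale h ≤ K fixed after Breaker's first move;
  -- X = K M keeps them nonnegative.
  M K X : ℕ
  M = ∣∣-sum relevant
  K = suc M
  X = K ℕ.* M

  position : ℕ → ℤ → ℤ
  position h e = + X + + h * e

  cell : ℕ → ℤ → ℕ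
  cell h e = ∣ position h e ∣

  relevant≢0 : ∀ {e} → e ∈ relevant → e ≢ 0ℤ
  relevant≢0 (here refl)                                                 = E≢0 P
  relevant≢0 (there (here refl))                                         = third≢0 P
  relevant≢0 (there (there (here refl)))                                 = last₁≢0 P
  relevant≢0 (there (there (there (here refl))))                         = last₂≢0 P
  relevant≢0 (there (there (there (there (here refl)))))                 = third≢0 Q
  relevant≢0 (there (there (there (there (there (here refl))))))         = last₁≢0 Q
  relevant≢0 (there (there (there (there (there (there (here refl))))))) = last₂≢0 Q

  pendingP⊆relevant : ∀ {e} → e ∈ pending P → e ∈ relevant
  pendingP⊆relevant = there ∘ ∈-++⁺ˡ

  pendingQ⊆relevant : ∀ {e} → e ∈ pending Q → e ∈ relevant
  pendingQ⊆relevant = there ∘ ∈-++⁺ʳ (pending P)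

  position-nonneg : ∀ {h e} → h ≤ K → e ∈ relevant → 0ℤ ℤ.≤ position h e
  position-nonneg {h} {e} h≤K e∈ = 0≤+X+h*e X h e (ℕP.*-mono-≤ h≤K (∈⇒∣∣≤∣∣-sum e∈))

  position-0 : ∀ h → position h 0ℤ ≡ + X
  position-0 h = trans (cong (λ z → + X + z) (ℤP.*-zeroʳ (+ h))) (ℤP.+-identityʳ (+ X))

  position-0-nonneg : ∀ h → 0ℤ ℤ.≤ position h 0ℤ
  position-0-nonneg h = subst (0ℤ ℤ.≤_) (sym (position-0 h)) (ℤ.+≤+ z≤n)

  cell-0 : ∀ h → cell h 0ℤ ≡ X
  cell-0 h = cong ∣_∣ (position-0 h)

  +cell : ∀ h e → 0ℤ ℤ.≤ position h e → + cell h e ≡ position h e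
  +cell h e = ℤP.0≤i⇒+∣i∣≡i

  position-injective : ∀ {h} → 0 < h → ∀ {e e'} → position h e ≡ position h e' → e ≡ e'
  position-injective {suc h} _ eq = ℤP.*-cancelˡ-≡ (+ suc h) _ _ (+-cancelˡ (+ X) _ _ eq)

  cell-injective : ∀ {h} → 0 < h → ∀ {e e'} → 0ℤ ℤ.≤ position h e → 0ℤ ℤ.≤ position h e' →
                   cell h e ≡ cell h e' → e ≡ e'
  cell-injective {h} h>0 {e} {e'} nonneg nonneg' eq =
    position-injective h>0 (trans (sym (+cell h e nonneg)) (trans (cong +_ eq) (+cell h e' nonneg')))

  -- If Breaker's first number is X + e, then it is not of the form X + K e', as |e| < K ≤ |K e'|.
  scale-avoiding : ∀ y → Σ ℕ λ h → 0 < h × h ≤ K × (∀ {e} → e ∈ relevant → position h e ≢ + y)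
  scale-avoiding y with ListAny.any? (λ e → position 1 e ℤ.≟ + y) relevant
  ... | no avoided = 1 , s≤s z≤n , s≤s z≤n , λ e∈ hit → avoided (lose e∈ hit)
  ... | yes hits with find hits
  ...   | e , e∈ , hit = K , s≤s z≤n , ℕP.≤-refl , λ e'∈ hit' → too-large e'∈ (trans hit (sym hit'))
    where
    too-large : ∀ {e'} → e' ∈ relevant → position 1 e ≡ position K e' → ⊥
    too-large {e'} e'∈ eq = ℕP.<-irrefl refl (ℕP.≤-trans K≤∣e∣ (∈⇒∣∣≤∣∣-sum e∈))
      where
      e≡Ke' : e ≡ + K * e'
      e≡Ke' = trans (sym (ℤP.*-identityˡ e)) (+-cancelˡ (+ X) _ _ eq)
      ∣e'∣>0 : 0 < ∣ e' ∣
      ∣e'∣>0 = ℕP.n≢0⇒n>0 (relevant≢0 e'∈ ∘ ℤP.∣i∣≡0⇒i≡0)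
      K≤∣e∣ : K ≤ ∣ e ∣
      K≤∣e∣ = begin
        K              ≡⟨ sym (ℕP.*-identityʳ K) ⟩
        K ℕ.* 1        ≤⟨ ℕP.*-monoʳ-≤ K ∣e'∣>0 ⟩
        K ℕ.* ∣ e' ∣   ≡⟨ sym (trans (cong ∣_∣ e≡Ke') (ℤP.∣i*j∣≡∣i∣*∣j∣ (+ K) e')) ⟩
        ∣ e ∣          ∎
        where open ℕP.≤-Reasoning

  module _ {h} (h>0 : 0 < h) where

    cell-distinct : ∀ {e e'} → 0ℤ ℤ.≤ position h e → 0ℤ ℤ.≤ position h e' → e ≢ e' → cell h e ≢ cell h e'
    cell-distinct nonneg nonneg' e≢e' = e≢e' ∘ cell-injective h>0 nonneg nonneg'

    cell-≢X : ∀ {e} → 0ℤ ℤ.≤ position h e → e ≢ 0ℤ → cell h e ≢ X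
    cell-≢X nonneg e≢0 eq = cell-distinct nonneg (position-0-nonneg h) e≢0 (trans eq (sym (cell-0 h)))

    cell-avoids : ∀ {e y} → 0ℤ ℤ.≤ position h e → position h e ≢ + y → cell h e ≢ y
    cell-avoids {e} nonneg avoids eq = avoids (trans (sym (+cell h e nonneg)) (cong +_ eq))

    copy⇒contains : ∀ {c t} → 0ℤ ℤ.≤ position h c → 0ℤ ℤ.≤ position h t → 0ℤ ℤ.≤ position h E →
                    Copy S (c ∷ t ∷ E ∷ 0ℤ ∷ []) → Contains S (cell h c ∷ cell h t ∷ cell h E ∷ X ∷ [])
    copy⇒contains {c} {t} c≥ t≥ E≥ C = h ℕ.* α C , ℕP.*-mono-≤ h>0 (α>0 C) , + X + + h * β C ,
      λ s s∈ → cell h (+ α C * + s + β C) , cell∈ (maps C s s∈) , (begin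
        + (h ℕ.* α C) * + s + (+ X + + h * β C)    ≡⟨ cong (λ a → a * + s + (+ X + + h * β C)) (ℤP.pos-* h (α C)) ⟩
        + h * + α C * + s + (+ X + + h * β C)      ≡⟨ distribute (+ h) (+ α C) (+ s) (β C) (+ X) ⟩
        position h (+ α C * + s + β C)             ≡⟨ sym (+cell h _ (nonneg (maps C s s∈))) ⟩
        + cell h (+ α C * + s + β C)               ∎)
      where
      open ≡-Reasoning
      distribute : ∀ a b c d x → a * b * c + (x + a * d) ≡ x + a * (b * c + d)
      distribute = solve-∀
      nonneg : ∀ {e} → e ∈ c ∷ t ∷ E ∷ 0ℤ ∷ [] → 0ℤ ℤ.≤ position h e
      nonneg (here refl)                         = c≥
      nonneg (there (here refl))                 = t≥
      nonneg (there (there (here refl)))         = E≥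
      nonneg (there (there (there (here refl)))) = position-0-nonneg h
      cell∈ : ∀ {e} → e ∈ c ∷ t ∷ E ∷ 0ℤ ∷ [] → cell h e ∈ cell h c ∷ cell h t ∷ cell h E ∷ X ∷ []
      cell∈ (here refl)                         = here refl
      cell∈ (there (here refl))                 = there (here refl)
      cell∈ (there (there (here refl)))         = there (there (here refl))
      cell∈ (there (there (there (here refl)))) = there (there (there (here (cell-0 h))))

    -- Breaker's third number blocks at most one of the two ways to complete S.
    win-with : ∀ (R : Plan S E) y₁ y₂ →
               (∀ {e} → e ∈ E ∷ pending R → 0ℤ ℤ.≤ position h e) →
               (∀ {e} → e ∈ pending R → position h e ≢ + y₁) →
               (∀ {e} → e ∈ pending R → position h e ≢ + y₂) →
               MakerWinsIn S 2 (cell h E ∷ X ∷ []) (y₂ ∷ y₁ ∷ [])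
    win-with R y₁ y₂ nonneg avoids₁ avoids₂ =
      cell h (third R) ,
      ∉-∷ (cell-distinct t≥ E≥ (third≢E R)) (∉-∷ (cell-≢X t≥ (third≢0 R)) ∉[]) ,
      ∉-∷ (cell-avoids t≥ (avoids₂ (here refl))) (∉-∷ (cell-avoids t≥ (avoids₁ (here refl))) ∉[]) ,
      inj₂ last-move
      where
      E≥  = nonneg (here refl)
      t≥  = nonneg (there (here refl))
      l₁≥ = nonneg (there (there (here refl)))
      l₂≥ = nonneg (there (there (there (here refl))))

      unclaimed : ∀ {c} → 0ℤ ℤ.≤ position h c → c ≢ third R → c ≢ E → c ≢ 0ℤ →
                  cell h c ∉ cell h (third R) ∷ cell h E ∷ X ∷ []
      unclaimed c≥ c≢t c≢E c≢0 =
        ∉-∷ (cell-distinct c≥ t≥ c≢t) (∉-∷ (cell-distinct c≥ E≥ c≢E) (∉-∷ (cell-≢X c≥ c≢0) ∉[]))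

      last-move : ∀ y → y ∉ cell h (third R) ∷ cell h E ∷ X ∷ [] → y ∉ y₂ ∷ y₁ ∷ [] →
                  MakerWinsIn S 1 (cell h (third R) ∷ cell h E ∷ X ∷ []) (y ∷ y₂ ∷ y₁ ∷ [])
      last-move y _ _ with cell h (last₁ R) ℕ.≟ y
      ... | yes blocked = cell h (last₂ R) ,
        unclaimed l₂≥ (last₂≢third R) (last₂≢E R) (last₂≢0 R) ,
        ∉-∷ (λ eq → cell-distinct l₁≥ l₂≥ (last₁≢last₂ R) (trans blocked (sym eq)))
          (∉-∷ (cell-avoids l₂≥ (avoids₂ (there (there (here refl)))))
            (∉-∷ (cell-avoids l₂≥ (avoids₁ (there (there (here refl))))) ∉[])) ,
        inj₁ (copy⇒contains l₂≥ t≥ E≥ (copy₂ R))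
      ... | no free = cell h (last₁ R) ,
        unclaimed l₁≥ (last₁≢third R) (last₁≢E R) (last₁≢0 R) ,
        ∉-∷ free
          (∉-∷ (cell-avoids l₁≥ (avoids₂ (there (here refl))))
            (∉-∷ (cell-avoids l₁≥ (avoids₁ (there (here refl)))) ∉[])) ,
        inj₁ (copy⇒contains l₁≥ t≥ E≥ (copy₁ R))

  strategy : HasStrategy 4 S
  strategy = X , ∉[] , ∉[] , inj₂ second-move
    where
    second-move : ∀ y₁ → y₁ ∉ X ∷ [] → y₁ ∉ [] → MakerWinsIn S 3 (X ∷ []) (y₁ ∷ [])
    second-move y₁ _ _ with scale-avoiding y₁
    ... | h , h>0 , h≤K , avoids₁ = cell h E ,
      ∉-∷ (cell-≢X h>0 E≥ (E≢0 P)) ∉[] ,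
      ∉-∷ (cell-avoids h>0 E≥ (avoids₁ (here refl))) ∉[] ,
      inj₂ third-move
      where
      E≥ : 0ℤ ℤ.≤ position h E
      E≥ = position-nonneg h≤K (here refl)

      nonneg-on : ∀ {R : Plan S E} → (∀ {e} → e ∈ pending R → e ∈ relevant) →
                  ∀ {e} → e ∈ E ∷ pending R → 0ℤ ℤ.≤ position h e
      nonneg-on ⊆relevant (here refl) = E≥
      nonneg-on ⊆relevant (there e∈) = position-nonneg h≤K (⊆relevant e∈)

      third-move : ∀ y₂ → y₂ ∉ cell h E ∷ X ∷ [] → y₂ ∉ y₁ ∷ [] →
                   MakerWinsIn S 2 (cell h E ∷ X ∷ []) (y₂ ∷ y₁ ∷ [])
      third-move y₂ _ _ with ListAny.any? (λ e → position h e ℤ.≟ + y₂) (pending P)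
      ... | no P-free = win-with h>0 P y₁ y₂ (nonneg-on {P} pendingP⊆relevant)
        (λ e∈ → avoids₁ (pendingP⊆relevant e∈)) (λ e∈ hit → P-free (lose e∈ hit))
      ... | yes P-hit with find P-hit
      ...   | e , e∈P , hit = win-with h>0 Q y₁ y₂ (nonneg-on {Q} pendingQ⊆relevant)
        (λ e∈ → avoids₁ (pendingQ⊆relevant e∈))
        (λ u∈Q hit' → disjoint e∈P (subst (_∈ pending Q) (position-injective h>0 (trans hit' (sym hit))) u∈Q))

-- Two copies of S sharing three points

dilate : ℕ → ℤ → ℤ → ℤ
dilate κ x u = + κ * (u - x)

dilate-injective : ∀ {κ} → 0 < κ → ∀ x {u v} → dilate κ x u ≡ dilate κ x v → u ≡ v
dilate-injective {suc κ} _ x {u} {v} eq = +-cancelʳ (- x) u v (ℤP.*-cancelˡ-≡ (+ suc κ) _ _ eq)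

dilate-centre : ∀ κ x → dilate κ x x ≡ 0ℤ
dilate-centre κ x = trans (cong (+ κ *_) (ℤP.+-inverseʳ x)) (ℤP.*-zeroʳ (+ κ))

Copy-⊆ : ∀ {S L L'} → (∀ {e} → e ∈ L → e ∈ L') → Copy S L → Copy S L'
Copy-⊆ L⊆L' C = record { α = α C ; α>0 = α>0 C ; β = β C ; maps = λ s s∈ → L⊆L' (maps C s s∈) }

dilate-copy : ∀ {S L} κ x → 0 < κ → Copy S L → Copy S (List.map (dilate κ x) L)
dilate-copy κ x κ>0 C = record
  { α    = κ ℕ.* α C
  ; α>0  = ℕP.*-mono-≤ κ>0 (α>0 C)
  ; β    = + κ * (β C - x)
  ; maps = λ s s∈ → subst (_∈ _) (sym (dilated s)) (∈-map⁺ (dilate κ x) (maps C s s∈))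
  }
  where
  dilated : ∀ s → + (κ ℕ.* α C) * + s + + κ * (β C - x) ≡ dilate κ x (+ α C * + s + β C)
  dilated s = trans (cong (λ a → a * + s + + κ * (β C - x)) (ℤP.pos-* κ (α C))) (expand (+ κ) (+ α C) (+ s) (β C) x)
    where
    expand : ∀ k a s b x → k * a * s + k * (b - x) ≡ k * ((a * s + b) - x)
    expand = solve-∀

-- Dilating about x by κP and by κQ exchanges the roles of z and w, so the two
-- resulting plans share their first two numbers 0 and E.
module FromConfiguration {S : List ℕ} {x z w c₁ c₂ : ℤ}
  (copy₁ : Copy S (c₁ ∷ w ∷ z ∷ x ∷ [])) (copy₂ : Copy S (c₂ ∷ w ∷ z ∷ x ∷ []))
  (κP κQ : ℕ) (κP>0 : 0 < κP) (κQ>0 : 0 < κQ) (exchange : dilate κQ x w ≡ dilate κP x z)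
  (separated : ∀ {u v} → u ∈ w ∷ c₁ ∷ c₂ ∷ [] → v ∈ z ∷ c₁ ∷ c₂ ∷ [] → dilate κP x u ≢ dilate κQ x v)
  where

  P' Q' : ℤ → ℤ
  P' = dilate κP x
  Q' = dilate κQ x

  E : ℤ
  E = P' z

  P'-distinct : ∀ {u v} → u ≢ v → P' u ≢ P' v
  P'-distinct u≢v = u≢v ∘ dilate-injective κP>0 x

  Q'-distinct : ∀ {u v} → u ≢ v → Q' u ≢ Q' v
  Q'-distinct u≢v = u≢v ∘ dilate-injective κQ>0 x

  P'-≢0 : ∀ {u} → u ≢ x → P' u ≢ 0ℤ
  P'-≢0 u≢x eq = P'-distinct u≢x (trans eq (sym (dilate-centre κP x)))

  Q'-≢0 : ∀ {u} → u ≢ x → Q' u ≢ 0ℤ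
  Q'-≢0 u≢x eq = Q'-distinct u≢x (trans eq (sym (dilate-centre κQ x)))

  Q'-≢E : ∀ {u} → u ≢ w → Q' u ≢ E
  Q'-≢E u≢w eq = Q'-distinct u≢w (trans eq (sym exchange))

  strategy : Unique (x ∷ z ∷ w ∷ c₁ ∷ c₂ ∷ []) → HasStrategy 4 S
  strategy ((x≢z ∷ x≢w ∷ x≢c₁ ∷ x≢c₂ ∷ []) ∷ (z≢w ∷ z≢c₁ ∷ z≢c₂ ∷ []) ∷ (w≢c₁ ∷ w≢c₂ ∷ []) ∷ (c₁≢c₂ ∷ []) ∷ _) =
    Strategy.strategy planP planQ disjoint
    where
    P-rearranged : ∀ c → All (_∈ P' c ∷ P' w ∷ E ∷ 0ℤ ∷ []) (List.map P' (c ∷ w ∷ z ∷ x ∷ []))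
    P-rearranged c = here refl ∷ there (here refl) ∷ there (there (here refl))
                   ∷ there (there (there (here (dilate-centre κP x)))) ∷ []

    Q-rearranged : ∀ c → All (_∈ Q' c ∷ Q' z ∷ E ∷ 0ℤ ∷ []) (List.map Q' (c ∷ w ∷ z ∷ x ∷ []))
    Q-rearranged c = here refl ∷ there (there (here exchange)) ∷ there (here refl)
                   ∷ there (there (there (here (dilate-centre κQ x)))) ∷ []

    planP : Plan S E
    planP = record
      { third = P' w ; last₁ = P' c₁ ; last₂ = P' c₂
      ; copy₁ = Copy-⊆ (All.lookup (P-rearranged c₁)) (dilate-copy κP x κP>0 copy₁)
      ; copy₂ = Copy-⊆ (All.lookup (P-rearranged c₂)) (dilate-copy κP x κP>0 copy₂)
      ; E≢0 = P'-≢0 (≢-sym x≢z) ; third≢0 = P'-≢0 (≢-sym x≢w) ; third≢E = P'-distinct (≢-sym z≢w)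
      ; last₁≢0 = P'-≢0 (≢-sym x≢c₁) ; last₁≢E = P'-distinct (≢-sym z≢c₁) ; last₁≢third = P'-distinct (≢-sym w≢c₁)
      ; last₂≢0 = P'-≢0 (≢-sym x≢c₂) ; last₂≢E = P'-distinct (≢-sym z≢c₂) ; last₂≢third = P'-distinct (≢-sym w≢c₂)
      ; last₁≢last₂ = P'-distinct c₁≢c₂
      }

    planQ : Plan S E
    planQ = record
      { third = Q' z ; last₁ = Q' c₁ ; last₂ = Q' c₂
      ; copy₁ = Copy-⊆ (All.lookup (Q-rearranged c₁)) (dilate-copy κQ x κQ>0 copy₁)
      ; copy₂ = Copy-⊆ (All.lookup (Q-rearranged c₂)) (dilate-copy κQ x κQ>0 copy₂)
      ; E≢0 = P'-≢0 (≢-sym x≢z) ; third≢0 = Q'-≢0 (≢-sym x≢z) ; third≢E = Q'-≢E z≢w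
      ; last₁≢0 = Q'-≢0 (≢-sym x≢c₁) ; last₁≢E = Q'-≢E (≢-sym w≢c₁) ; last₁≢third = Q'-distinct (≢-sym z≢c₁)
      ; last₂≢0 = Q'-≢0 (≢-sym x≢c₂) ; last₂≢E = Q'-≢E (≢-sym w≢c₂) ; last₂≢third = Q'-distinct (≢-sym z≢c₂)
      ; last₁≢last₂ = Q'-distinct c₁≢c₂
      }

    disjoint : ∀ {u} → u ∈ pending planP → u ∉ pending planQ
    disjoint u∈P u∈Q with ∈-map⁻ P' {xs = w ∷ c₁ ∷ c₂ ∷ []} u∈P | ∈-map⁻ Q' {xs = z ∷ c₁ ∷ c₂ ∷ []} u∈Q
    ... | a , a∈ , refl | b , b∈ , Pa≡Qb = separated a∈ b∈ Pa≡Qb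

<⇒0<- : ∀ {a b} → a ℤ.< b → 0ℤ ℤ.< b - a
<⇒0<- {a} {b} a<b = subst (ℤ._< b - a) (ℤP.+-inverseʳ a) (ℤP.+-monoˡ-< (- a) a<b)

<-by-difference : ∀ {a b t} → b - a ≡ t → 0ℤ ℤ.< t → a ℤ.< b
<-by-difference {a} {b} b-a≡t 0<t =
  subst₂ ℤ._<_ (ℤP.+-identityʳ a) (cancel a b) (ℤP.+-monoʳ-< a (subst (0ℤ ℤ.<_) (sym b-a≡t) 0<t))
  where
  cancel : ∀ a b → a + (b - a) ≡ b
  cancel = solve-∀

*-pos : ∀ {a b} → 0ℤ ℤ.< a → 0ℤ ℤ.< b → 0ℤ ℤ.< a * b
*-pos {a} {b} 0<a 0<b = subst (ℤ._< a * b) (ℤP.*-zeroʳ a) (ℤP.*-monoˡ-<-pos a {{ℤ.positive 0<a}} 0<b)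

+-pos : ∀ {a b} → 0ℤ ℤ.< a → 0ℤ ℤ.< b → 0ℤ ℤ.< a + b
+-pos {a} {b} 0<a 0<b = ℤP.<-trans 0<a (subst (ℤ._< a + b) (ℤP.+-identityʳ a) (ℤP.+-monoʳ-< a 0<b))

step-< : ∀ a {t} → 0ℤ ℤ.< t → a ℤ.< a + t
step-< a {t} 0<t = subst (ℤ._< a + t) (ℤP.+-identityʳ a) (ℤP.+-monoʳ-< a 0<t)

>⇒≢ : ∀ {a b} → b ℤ.< a → a ≢ b
>⇒≢ b<a = ≢-sym (ℤP.<⇒≢ b<a)

module RightConfiguration {x z w c₁ c₂ : ℤ}
  (c₁<x : c₁ ℤ.< x) (x<z : x ℤ.< z) (z<w : z ℤ.< w) (z<c₂ : z ℤ.< c₂) (c₂≢w : c₂ ≢ w)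
  (nondegenerate : (z - x) * (c₂ - x) ≢ (w - x) * (w - x)) where

  kw kz : ℤ
  kw = w - x
  kz = z - x

  P Q : ℤ → ℤ
  P u = kw * (u - x)
  Q u = kz * (u - x)

  x<w : x ℤ.< w
  x<w = ℤP.<-trans x<z z<w

  x<c₂ : x ℤ.< c₂
  x<c₂ = ℤP.<-trans x<z z<c₂

  kw>0 : 0ℤ ℤ.< kw
  kw>0 = <⇒0<- x<w

  kz>0 : 0ℤ ℤ.< kz
  kz>0 = <⇒0<- x<z

  kz<kw : kz ℤ.< kw
  kz<kw = ℤP.+-monoˡ-< (- x) z<w

  exchange : Q w ≡ P z
  exchange = ℤP.*-comm kz kw

  P-mono : ∀ {u v} → u ℤ.< v → P u ℤ.< P v
  P-mono u<v = ℤP.*-monoˡ-<-pos kw {{ℤ.positive kw>0}} (ℤP.+-monoˡ-< (- x) u<v)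

  Q-mono : ∀ {u v} → u ℤ.< v → Q u ℤ.< Q v
  Q-mono u<v = ℤP.*-monoˡ-<-pos kz {{ℤ.positive kz>0}} (ℤP.+-monoˡ-< (- x) u<v)

  below-centre : ∀ k → 0ℤ ℤ.< k → k * (c₁ - x) ℤ.< 0ℤ
  below-centre k 0<k = subst (k * (c₁ - x) ℤ.<_) (ℤP.*-zeroʳ k)
    (ℤP.*-monoˡ-<-pos k {{ℤ.positive 0<k}} (subst (c₁ - x ℤ.<_) (ℤP.+-inverseʳ x) (ℤP.+-monoˡ-< (- x) c₁<x)))

  above-centre : ∀ k u → 0ℤ ℤ.< k → x ℤ.< u → 0ℤ ℤ.< k * (u - x)
  above-centre k u 0<k x<u = *-pos 0<k (<⇒0<- x<u)

  Qz<Pz : Q z ℤ.< P z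
  Qz<Pz = subst (Q z ℤ.<_) exchange (Q-mono z<w)

  separated : ∀ {u v} → u ∈ w ∷ c₁ ∷ c₂ ∷ [] → v ∈ z ∷ c₁ ∷ c₂ ∷ [] → P u ≢ Q v
  separated (here refl) (here refl) =
    >⇒≢ (ℤP.<-trans Qz<Pz (P-mono z<w))
  separated (here refl) (there (here refl)) =
    >⇒≢ (ℤP.<-trans (below-centre kz kz>0) (above-centre kw w kw>0 x<w))
  separated (here refl) (there (there (here refl))) =
    nondegenerate ∘ sym
  separated (there (here refl)) (here refl) =
    ℤP.<⇒≢ (ℤP.<-trans (below-centre kw kw>0) (above-centre kz z kz>0 x<z))
  separated (there (here refl)) (there (here refl)) =
    ℤP.<⇒≢ (ℤP.*-monoʳ-<-neg (c₁ - x) {{ℤ.negative (subst (c₁ - x ℤ.<_) (ℤP.+-inverseʳ x) (ℤP.+-monoˡ-< (- x) c₁<x))}} kz<kw)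
  separated (there (here refl)) (there (there (here refl))) =
    ℤP.<⇒≢ (ℤP.<-trans (below-centre kw kw>0) (above-centre kz c₂ kz>0 x<c₂))
  separated (there (there (here refl))) (here refl) =
    >⇒≢ (ℤP.<-trans Qz<Pz (P-mono z<c₂))
  separated (there (there (here refl))) (there (here refl)) =
    >⇒≢ (ℤP.<-trans (below-centre kz kz>0) (above-centre kw c₂ kw>0 x<c₂))
  separated (there (there (here refl))) (there (there (here refl))) =
    >⇒≢ (ℤP.*-monoʳ-<-pos (c₂ - x) {{ℤ.positive (<⇒0<- x<c₂)}} kz<kw)

  distinct : Unique (x ∷ z ∷ w ∷ c₁ ∷ c₂ ∷ [])
  distinct = (ℤP.<⇒≢ x<z ∷ ℤP.<⇒≢ x<w ∷ >⇒≢ c₁<x ∷ ℤP.<⇒≢ x<c₂ ∷ [])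
           ∷ (ℤP.<⇒≢ z<w ∷ >⇒≢ (ℤP.<-trans c₁<x x<z) ∷ ℤP.<⇒≢ z<c₂ ∷ [])
           ∷ (>⇒≢ (ℤP.<-trans c₁<x x<w) ∷ ≢-sym c₂≢w ∷ [])
           ∷ (ℤP.<⇒≢ (ℤP.<-trans c₁<x x<c₂) ∷ [])
           ∷ [] ∷ []

nondegenerate-if-c₂<w : ∀ {x z w c₂} → x ℤ.< z → z ℤ.< w → c₂ ℤ.< w → (z - x) * (c₂ - x) ≢ (w - x) * (w - x)
nondegenerate-if-c₂<w {x} {z} {w} {c₂} x<z z<w c₂<w = ℤP.<⇒≢ (ℤP.<-trans
  (ℤP.*-monoˡ-<-pos (z - x) {{ℤ.positive (<⇒0<- x<z)}} (ℤP.+-monoˡ-< (- x) c₂<w))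
  (ℤP.*-monoʳ-<-pos (w - x) {{ℤ.positive (<⇒0<- (ℤP.<-trans x<z z<w))}} (ℤP.+-monoˡ-< (- x) z<w)))

+∣∣-of-pos : ∀ {k} → 0ℤ ℤ.< k → + ∣ k ∣ ≡ k
+∣∣-of-pos = ℤP.0≤i⇒+∣i∣≡i ∘ ℤP.<⇒≤

∣∣-pos : ∀ {k} → 0ℤ ℤ.< k → 0 < ∣ k ∣
∣∣-pos 0<k = ℤP.drop‿+<+ (subst (0ℤ ℤ.<_) (sym (+∣∣-of-pos 0<k)) 0<k)

module _ {S : List ℕ} {x z w c₁ c₂ : ℤ} (copy₁ : Copy S (c₁ ∷ w ∷ z ∷ x ∷ [])) (copy₂ : Copy S (c₂ ∷ w ∷ z ∷ x ∷ [])) where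

  right-configuration⇒strategy : c₁ ℤ.< x → x ℤ.< z → z ℤ.< w → z ℤ.< c₂ → c₂ ≢ w →
                                 (z - x) * (c₂ - x) ≢ (w - x) * (w - x) → HasStrategy 4 S
  right-configuration⇒strategy c₁<x x<z z<w z<c₂ c₂≢w nondegenerate =
    FromConfiguration.strategy copy₁ copy₂ ∣ kw ∣ ∣ kz ∣ (∣∣-pos kw>0) (∣∣-pos kz>0)
      (subst₂ (λ a b → a * (w - x) ≡ b * (z - x)) (sym (+∣∣-of-pos kz>0)) (sym (+∣∣-of-pos kw>0)) exchange)
      (λ u∈ v∈ → separated u∈ v∈ ∘ subst₂ (λ a b → a * _ ≡ b * _) (+∣∣-of-pos kw>0) (+∣∣-of-pos kz>0))
      distinct
    where open RightConfiguration c₁<x x<z z<w z<c₂ c₂≢w nondegenerate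

  -- The mirror image of the previous configuration, reduced to it by negation.
  left-configuration⇒strategy : x ℤ.< c₁ → z ℤ.< x → w ℤ.< z → c₂ ℤ.< z → w ℤ.< c₂ → HasStrategy 4 S
  left-configuration⇒strategy x<c₁ z<x w<z c₂<z w<c₂ =
    FromConfiguration.strategy copy₁ copy₂ ∣ kw ∣ ∣ kz ∣ (∣∣-pos kw>0) (∣∣-pos kz>0)
      (subst₂ (λ a b → a * (w - x) ≡ b * (z - x)) (sym (trans (+∣∣-of-pos kz>0) (flip-gap z)))
        (sym (trans (+∣∣-of-pos kw>0) (flip-gap w))) (exchange-flipped x z w))
      separated⁻
      (AllPairs.map (λ ne eq → ne (cong -_ eq)) (AllPairsP.map⁻ distinct))
    where
    open RightConfiguration (ℤP.neg-mono-< x<c₁) (ℤP.neg-mono-< z<x) (ℤP.neg-mono-< w<z) (ℤP.neg-mono-< c₂<z)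
      (ℤP.<⇒≢ (ℤP.neg-mono-< w<c₂)) (nondegenerate-if-c₂<w (ℤP.neg-mono-< z<x) (ℤP.neg-mono-< w<z) (ℤP.neg-mono-< w<c₂))

    flip-gap : ∀ u → - u - - x ≡ x - u
    flip-gap u = solve′ x u
      where
      solve′ : ∀ x u → - u - - x ≡ x - u
      solve′ = solve-∀

    exchange-flipped : ∀ x z w → (x - z) * (w - x) ≡ (x - w) * (z - x)
    exchange-flipped = solve-∀

    mirror : ∀ k u → k * (u - x) ≡ - (k * (- u - - x))
    mirror k u = mirror′ k u x
      where
      mirror′ : ∀ k u x → k * (u - x) ≡ - (k * (- u - - x))
      mirror′ = solve-∀

    separated⁻ : ∀ {u v} → u ∈ w ∷ c₁ ∷ c₂ ∷ [] → v ∈ z ∷ c₁ ∷ c₂ ∷ [] →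
                 dilate (∣ kw ∣) x u ≢ dilate (∣ kz ∣) x v
    separated⁻ {u} {v} u∈ v∈ eq = separated (∈-map⁺ -_ u∈) (∈-map⁺ -_ v∈) (ℤP.neg-injective (begin
      - P (- u)                          ≡⟨ cong (λ k → - (k * (- u - - x))) (sym (+∣∣-of-pos kw>0)) ⟩
      - (+ ∣ kw ∣ * (- u - - x))         ≡⟨ sym (mirror (+ ∣ kw ∣) u) ⟩
      dilate (∣ kw ∣) x u                ≡⟨ eq ⟩
      dilate (∣ kz ∣) x v                ≡⟨ mirror (+ ∣ kz ∣) v ⟩
      - (+ ∣ kz ∣ * (- v - - x))         ≡⟨ cong (λ k → - (k * (- v - - x))) (+∣∣-of-pos kz>0) ⟩
      - Q (- v)                          ∎))
      where open ≡-Reasoning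

-- The three symmetric shapes

module Gaps {s₁ s₂ s₃ s₄ : ℕ} (s₁<s₂ : s₁ < s₂) (s₂<s₃ : s₂ < s₃) (s₃<s₄ : s₃ < s₄) where

  S : List ℕ
  S = toList (s₁ ∷ s₂ ∷ s₃ ∷ s₄ ∷ [])

  D₁ D₂ D₃ : ℤ
  D₁ = + s₂ - + s₁
  D₂ = + s₃ - + s₂
  D₃ = + s₄ - + s₃

  D₁>0 : 0ℤ ℤ.< D₁
  D₁>0 = <⇒0<- (ℤ.+<+ s₁<s₂)

  D₂>0 : 0ℤ ℤ.< D₂
  D₂>0 = <⇒0<- (ℤ.+<+ s₂<s₃)

  D₃>0 : 0ℤ ℤ.< D₃
  D₃>0 = <⇒0<- (ℤ.+<+ s₃<s₄)

  copy-of-walk : ∀ {L} A → 0ℤ ℤ.< A → ∀ {v₁ v₂ v₃ v₄} →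
                 v₂ ≡ v₁ + A * D₁ → v₃ ≡ v₂ + A * D₂ → v₄ ≡ v₃ + A * D₃ →
                 All (_∈ L) (v₁ ∷ v₂ ∷ v₃ ∷ v₄ ∷ []) → Copy S L
  copy-of-walk {L} A A>0 {v₁} {v₂} {v₃} {v₄} step₁ step₂ step₃ (v₁∈ ∷ v₂∈ ∷ v₃∈ ∷ v₄∈ ∷ []) = record
    { α = ∣ A ∣ ; α>0 = ∣∣-pos A>0 ; β = offset
    ; maps = λ s s∈ → subst (λ a → a * + s + offset ∈ L) (sym (+∣∣-of-pos A>0)) (on-walk s∈)
    }
    where
    offset : ℤ
    offset = v₁ - A * + s₁

    advance : ∀ t t' {v w} → A * t + offset ≡ v → w ≡ v + A * (t' - t) → A * t' + offset ≡ w
    advance t t' at-t w≡ = trans (split A t t' offset) (trans (cong (λ z → z + A * (t' - t)) at-t) (sym w≡))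
      where
      split : ∀ A t t' β → A * t' + β ≡ (A * t + β) + A * (t' - t)
      split = solve-∀

    at₁ : A * + s₁ + offset ≡ v₁
    at₁ = cancel A (+ s₁) v₁
      where
      cancel : ∀ A s v → A * s + (v - A * s) ≡ v
      cancel = solve-∀

    at₂ : A * + s₂ + offset ≡ v₂
    at₂ = advance (+ s₁) (+ s₂) at₁ step₁

    at₃ : A * + s₃ + offset ≡ v₃
    at₃ = advance (+ s₂) (+ s₃) at₂ step₂

    at₄ : A * + s₄ + offset ≡ v₄
    at₄ = advance (+ s₃) (+ s₄) at₃ step₃

    on-walk : ∀ {s} → s ∈ S → A * + s + offset ∈ L
    on-walk (here refl)                         = subst (_∈ L) (sym at₁) v₁∈
    on-walk (there (here refl))                 = subst (_∈ L) (sym at₂) v₂∈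
    on-walk (there (there (here refl)))         = subst (_∈ L) (sym at₃) v₃∈
    on-walk (there (there (there (here refl)))) = subst (_∈ L) (sym at₄) v₄∈

  1st : ∀ {a b c d : ℤ} → a ∈ a ∷ b ∷ c ∷ d ∷ []
  1st = here refl

  2nd : ∀ {a b c d : ℤ} → b ∈ a ∷ b ∷ c ∷ d ∷ []
  2nd = there (here refl)

  3rd : ∀ {a b c d : ℤ} → c ∈ a ∷ b ∷ c ∷ d ∷ []
  3rd = there (there (here refl))

  4th : ∀ {a b c d : ℤ} → d ∈ a ∷ b ∷ c ∷ d ∷ []
  4th = there (there (there (here refl)))

  data SymmetricGaps : Set where
    drop₁≅drop₄ : D₂ * D₂ ≡ D₁ * D₃           → SymmetricGaps
    drop₁≅drop₃ : D₁ * D₃ ≡ D₂ * D₂ + D₂ * D₃ → SymmetricGaps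
    drop₂≅drop₄ : D₁ * D₃ ≡ D₁ * D₂ + D₂ * D₂ → SymmetricGaps

  gaps⇒strategy : SymmetricGaps → HasStrategy 4 S
  gaps⇒strategy (drop₁≅drop₄ rel) =
    right-configuration⇒strategy {x = u₂} {u₃} {u₄} {u₁} {u₅}
      (copy-of-walk D₂ D₂>0 refl refl refl (1st ∷ 4th ∷ 3rd ∷ 2nd ∷ []))
      (copy-of-walk D₃ D₃>0 (cong (λ t → u₂ + t) (trans rel (ℤP.*-comm D₁ D₃))) (cong (λ t → u₃ + t) (ℤP.*-comm D₂ D₃)) refl
        (4th ∷ 3rd ∷ 2nd ∷ 1st ∷ []))
      (step-< u₁ (*-pos D₂>0 D₁>0)) (step-< u₂ (*-pos D₂>0 D₂>0)) (step-< u₃ (*-pos D₂>0 D₃>0))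
      (ℤP.<-trans (step-< u₃ (*-pos D₂>0 D₃>0)) (step-< u₄ (*-pos D₃>0 D₃>0)))
      (>⇒≢ (step-< u₄ (*-pos D₃>0 D₃>0)))
      (ℤP.<⇒≢ (<-by-difference (excess u₂ D₂ D₃) (*-pos (*-pos (*-pos D₂>0 D₂>0) D₂>0) D₃>0)))
    where
    u₁ u₂ u₃ u₄ u₅ : ℤ
    u₁ = 0ℤ
    u₂ = u₁ + D₂ * D₁
    u₃ = u₂ + D₂ * D₂
    u₄ = u₃ + D₂ * D₃
    u₅ = u₄ + D₃ * D₃
    excess : ∀ a D₂ D₃ →
      ((a + D₂ * D₂ + D₂ * D₃) - a) * ((a + D₂ * D₂ + D₂ * D₃) - a)
        - ((a + D₂ * D₂) - a) * ((a + D₂ * D₂ + D₂ * D₃ + D₃ * D₃) - a) ≡ D₂ * D₂ * D₂ * D₃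
    excess = solve-∀
  gaps⇒strategy (drop₁≅drop₃ rel) =
    right-configuration⇒strategy {x = u₂} {u₃} {u₅} {u₁} {u₄}
      (copy-of-walk D₁ D₁>0 refl refl (trans (ℤP.+-assoc u₃ (D₂ * D₂) (D₂ * D₃)) (cong (λ t → u₃ + t) (sym rel)))
        (1st ∷ 4th ∷ 3rd ∷ 2nd ∷ []))
      (copy-of-walk D₂ D₂>0 (cong (λ t → u₂ + t) (ℤP.*-comm D₁ D₂)) refl refl (4th ∷ 3rd ∷ 1st ∷ 2nd ∷ []))
      (step-< u₁ (*-pos D₁>0 D₁>0)) (step-< u₂ (*-pos D₁>0 D₂>0)) u₃<u₅ (step-< u₃ (*-pos D₂>0 D₂>0))
      (ℤP.<⇒≢ u₄<u₅) (nondegenerate-if-c₂<w (step-< u₂ (*-pos D₁>0 D₂>0)) u₃<u₅ u₄<u₅)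
    where
    u₁ u₂ u₃ u₄ u₅ : ℤ
    u₁ = 0ℤ
    u₂ = u₁ + D₁ * D₁
    u₃ = u₂ + D₁ * D₂
    u₄ = u₃ + D₂ * D₂
    u₅ = u₄ + D₂ * D₃
    u₄<u₅ : u₄ ℤ.< u₅
    u₄<u₅ = step-< u₄ (*-pos D₂>0 D₃>0)
    u₃<u₅ : u₃ ℤ.< u₅
    u₃<u₅ = ℤP.<-trans (step-< u₃ (*-pos D₂>0 D₂>0)) u₄<u₅
  gaps⇒strategy (drop₂≅drop₄ rel) =
    left-configuration⇒strategy {x = u₄} {u₃} {u₁} {u₅} {u₂}
      (copy-of-walk D₃ D₃>0
        (trans (ℤP.+-assoc u₁ (D₁ * D₂) (D₂ * D₂)) (cong (λ t → u₁ + t) (trans (sym rel) (ℤP.*-comm D₁ D₃)))) refl refl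
        (2nd ∷ 3rd ∷ 4th ∷ 1st ∷ []))
      (copy-of-walk D₂ D₂>0 (cong (λ t → u₁ + t) (ℤP.*-comm D₁ D₂)) refl (cong (λ t → u₃ + t) (ℤP.*-comm D₃ D₂))
        (2nd ∷ 1st ∷ 3rd ∷ 4th ∷ []))
      (step-< u₄ (*-pos D₃>0 D₃>0)) (step-< u₃ (*-pos D₃>0 D₂>0))
      (ℤP.<-trans u₁<u₂ (step-< u₂ (*-pos D₂>0 D₂>0))) (step-< u₂ (*-pos D₂>0 D₂>0)) u₁<u₂
    where
    u₁ u₂ u₃ u₄ u₅ : ℤ
    u₁ = 0ℤ
    u₂ = u₁ + D₁ * D₂
    u₃ = u₂ + D₂ * D₂
    u₄ = u₃ + D₃ * D₂
    u₅ = u₄ + D₃ * D₃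
    u₁<u₂ : u₁ ℤ.< u₂
    u₁<u₂ = step-< u₁ (*-pos D₁>0 D₂>0)

-- Symmetry forces one of the three shapes

record IntegerAffine : Set where
  field
    slope   : ℕ
    slope>0 : 0 < slope
    offset  : ℤ
    denom   : ℕ
    denom>0 : 0 < denom

  Maps : ℕ → ℕ → Set
  Maps r r' = + slope * + r + offset ≡ + r' * + denom

  maps-strictMono : ∀ {r₁ r₂ t₁ t₂} → r₁ < r₂ → Maps r₁ t₁ → Maps r₂ t₂ → t₁ < t₂
  maps-strictMono r₁<r₂ m₁ m₂ = ℤP.drop‿+<+ (ℤP.*-cancelʳ-<-nonNeg (+ denom)
    (subst₂ ℤ._<_ m₁ m₂ (affine-strictMono slope offset slope>0 r₁<r₂)))

open IntegerAffine using (Maps; maps-strictMono)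

positive-rational-affine⇒ℤ : ∀ (a b : ℚ) → ℚ.Positive a →
  Σ IntegerAffine λ f → ∀ r r' → a ℚ.* ℕtoℚ r ℚ.+ b ≡ ℕtoℚ r' → Maps f r r'
positive-rational-affine⇒ℤ a@(mkℚ ℤ.+[1+ n ] da _) b@(mkℚ B db _) _ =
  record { slope = suc n ℕ.* suc db ; slope>0 = s≤s z≤n ; offset = B * + suc da
         ; denom = suc da ℕ.* suc db ; denom>0 = s≤s z≤n } ,
  λ r r' eq → begin
    + (suc n ℕ.* suc db) * + r + B * + suc da       ≡⟨ cong (λ t → t * + r + B * + suc da) (ℤP.pos-* (suc n) (suc db)) ⟩
    + suc n * + suc db * + r + B * + suc da         ≡⟨ reorder (+ suc n) (+ r) (+ suc db) (B * + suc da) ⟩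
    + suc n * + r * + suc db + B * + suc da         ≡⟨ ℚ-affine⇒ℤ a b r r' eq ⟩
    + r' * (+ suc da * + suc db)                    ≡⟨ cong (+ r' *_) (sym (ℤP.pos-* (suc da) (suc db))) ⟩
    + r' * + (suc da ℕ.* suc db)                    ∎
  where
  open ≡-Reasoning
  reorder : ∀ A R D C → A * D * R + C ≡ A * R * D + C
  reorder = solve-∀

affine-preserves-gap-ratio : ∀ (f : IntegerAffine) {r₁ r₂ r₃ t₁ t₂ t₃} → Maps f r₁ t₁ → Maps f r₂ t₂ → Maps f r₃ t₃ →
               (+ r₂ - + r₁) * (+ t₃ - + t₂) ≡ (+ r₃ - + r₂) * (+ t₂ - + t₁)
affine-preserves-gap-ratio f {r₁} {r₂} {r₃} {t₁} {t₂} {t₃} m₁ m₂ m₃ =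
  ℤP.*-cancelˡ-≡ K _ _ {{ℕ.>-nonZero (IntegerAffine.denom>0 f)}} (begin
    K * ((R₂ - R₁) * (T₃ - T₂))             ≡⟨ clear K R₁ R₂ T₂ T₃ ⟩
    (R₂ - R₁) * (T₃ * K - T₂ * K)           ≡⟨ cong₂ (λ p q → (R₂ - R₁) * (p - q)) (sym m₃) (sym m₂) ⟩
    (R₂ - R₁) * ((A * R₃ + C) - (A * R₂ + C)) ≡⟨ swap-gaps A C R₁ R₂ R₃ ⟩
    (R₃ - R₂) * ((A * R₂ + C) - (A * R₁ + C)) ≡⟨ cong₂ (λ p q → (R₃ - R₂) * (p - q)) m₂ m₁ ⟩
    (R₃ - R₂) * (T₂ * K - T₁ * K)           ≡⟨ sym (clear K R₂ R₃ T₁ T₂) ⟩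
    K * ((R₃ - R₂) * (T₂ - T₁))             ∎)
  where
  open ≡-Reasoning
  open IntegerAffine f
  K A C R₁ R₂ R₃ T₁ T₂ T₃ : ℤ
  K = + denom ; A = + slope ; C = offset
  R₁ = + r₁ ; R₂ = + r₂ ; R₃ = + r₃
  T₁ = + t₁ ; T₂ = + t₂ ; T₃ = + t₃
  clear : ∀ K a b T T' → K * ((b - a) * (T' - T)) ≡ (b - a) * (T' * K - T * K)
  clear = solve-∀
  swap-gaps : ∀ α c R₁ R₂ R₃ → (R₂ - R₁) * ((α * R₃ + c) - (α * R₂ + c)) ≡ (R₃ - R₂) * ((α * R₂ + c) - (α * R₁ + c))
  swap-gaps = solve-∀

module _ {t₁ t₂ t₃ : ℕ} (t₁<t₂ : t₁ < t₂) (t₂<t₃ : t₂ < t₃) where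

  private
    bounds : ∀ {x} → x ∈ t₁ ∷ t₂ ∷ t₃ ∷ [] → t₁ ≤ x × x ≤ t₃
    bounds (here refl)                 = ℕP.≤-refl , ℕP.<⇒≤ (ℕP.<-trans t₁<t₂ t₂<t₃)
    bounds (there (here refl))         = ℕP.<⇒≤ t₁<t₂ , ℕP.<⇒≤ t₂<t₃
    bounds (there (there (here refl))) = ℕP.<⇒≤ (ℕP.<-trans t₁<t₂ t₂<t₃) , ℕP.≤-refl

    below-middle : ∀ {x} → x < t₂ → x ∈ t₁ ∷ t₂ ∷ t₃ ∷ [] → x ≡ t₁
    below-middle _    (here refl)                 = refl
    below-middle x<t₂ (there (here refl))         = ⊥-elim (ℕP.<-irrefl refl x<t₂)
    below-middle x<t₂ (there (there (here refl))) = ⊥-elim (ℕP.<-asym x<t₂ t₂<t₃)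

    above-middle : ∀ {x} → t₂ < x → x ∈ t₁ ∷ t₂ ∷ t₃ ∷ [] → x ≡ t₃
    above-middle t₂<x (here refl)                 = ⊥-elim (ℕP.<-asym t₂<x t₁<t₂)
    above-middle t₂<x (there (here refl))         = ⊥-elim (ℕP.<-irrefl refl t₂<x)
    above-middle _    (there (there (here refl))) = refl

  sorted-into-sorted : ∀ {a b c} → a < b → b < c →
                       a ∈ t₁ ∷ t₂ ∷ t₃ ∷ [] → b ∈ t₁ ∷ t₂ ∷ t₃ ∷ [] → c ∈ t₁ ∷ t₂ ∷ t₃ ∷ [] →
                       a ≡ t₁ × b ≡ t₂ × c ≡ t₃
  sorted-into-sorted a<b b<c a∈ (here refl)                 c∈ = ⊥-elim (ℕP.<⇒≱ a<b (proj₁ (bounds a∈)))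
  sorted-into-sorted a<b b<c a∈ (there (there (here refl))) c∈ = ⊥-elim (ℕP.<⇒≱ b<c (proj₂ (bounds c∈)))
  sorted-into-sorted a<b b<c a∈ (there (here refl))         c∈ = below-middle a<b a∈ , refl , above-middle b<c c∈

copy⇒gap-ratio : ∀ {r₁ r₂ r₃ t₁ t₂ t₃} → r₁ < r₂ → r₂ < r₃ → t₁ < t₂ → t₂ < t₃ →
                 IsCopy (t₁ ∷ t₂ ∷ t₃ ∷ []) (r₁ ∷ r₂ ∷ r₃ ∷ []) →
                 (+ r₂ - + r₁) * (+ t₃ - + t₂) ≡ (+ r₃ - + r₂) * (+ t₂ - + t₁)
copy⇒gap-ratio {r₁} {r₂} {r₃} r₁<r₂ r₂<r₃ t₁<t₂ t₂<t₃ (a , a>0 , b , forth , _)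
  with positive-rational-affine⇒ℤ a b a>0
     | forth r₁ (here refl) | forth r₂ (there (here refl)) | forth r₃ (there (there (here refl)))
... | f , in-ℤ | x₁ , x₁∈ , e₁ | x₂ , x₂∈ , e₂ | x₃ , x₃∈ , e₃
  with sorted-into-sorted t₁<t₂ t₂<t₃ (maps-strictMono f {t₁ = x₁} {x₂} r₁<r₂ (in-ℤ r₁ x₁ e₁) (in-ℤ r₂ x₂ e₂))
                          (maps-strictMono f {t₁ = x₂} {x₃} r₂<r₃ (in-ℤ r₂ x₂ e₂) (in-ℤ r₃ x₃ e₃)) x₁∈ x₂∈ x₃∈
... | refl , refl , refl = affine-preserves-gap-ratio f {r₁} {r₂} {r₃} {x₁} {x₂} {x₃} (in-ℤ r₁ x₁ e₁) (in-ℤ r₂ x₂ e₂) (in-ℤ r₃ x₃ e₃)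

≡⇒difference-≡ : ∀ {x y a b} → x ≡ y → x - y ≡ a - b → a ≡ b
≡⇒difference-≡ x≡y diff = ℤP.i-j≡0⇒i≡j _ _ (trans (sym diff) (ℤP.i≡j⇒i-j≡0 x≡y))

≡⇒difference-≯0 : ∀ {x y t} → x ≡ y → x - y ≡ t → 0ℤ ℤ.< t → ⊥
≡⇒difference-≯0 x≡y diff 0<t = ℤP.<⇒≢ 0<t (sym (trans (sym diff) (ℤP.i≡j⇒i-j≡0 x≡y)))

module _ {s₁ s₂ s₃ s₄ : ℕ} (s₁<s₂ : s₁ < s₂) (s₂<s₃ : s₂ < s₃) (s₃<s₄ : s₃ < s₄) where

  open Gaps s₁<s₂ s₂<s₃ s₃<s₄

  S₁ S₂ S₃ S₄ : ℤ
  S₁ = + s₁ ; S₂ = + s₂ ; S₃ = + s₃ ; S₄ = + s₄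

  s₁<s₃ : s₁ < s₃
  s₁<s₃ = ℕP.<-trans s₁<s₂ s₂<s₃

  s₂<s₄ : s₂ < s₄
  s₂<s₄ = ℕP.<-trans s₂<s₃ s₃<s₄

  symmetric⇒gaps : Symmetric (s₁ ∷ s₂ ∷ s₃ ∷ s₄ ∷ []) → SymmetricGaps
  symmetric⇒gaps (zero , suc zero , _ , copy) =
    ⊥-elim (≡⇒difference-≯0 (copy⇒gap-ratio s₁<s₃ s₃<s₄ s₂<s₃ s₃<s₄ copy) (diff S₁ S₂ S₃ S₄) (*-pos D₁>0 D₃>0))
    where
    diff : ∀ S₁ S₂ S₃ S₄ → (S₃ - S₁) * (S₄ - S₃) - (S₄ - S₃) * (S₃ - S₂) ≡ (S₂ - S₁) * (S₄ - S₃)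
    diff = solve-∀
  symmetric⇒gaps (zero , suc (suc zero) , _ , copy) =
    drop₁≅drop₃ (≡⇒difference-≡ (copy⇒gap-ratio s₁<s₂ s₂<s₄ s₂<s₃ s₃<s₄ copy) (diff S₁ S₂ S₃ S₄))
    where
    diff : ∀ S₁ S₂ S₃ S₄ → (S₂ - S₁) * (S₄ - S₃) - (S₄ - S₂) * (S₃ - S₂)
                         ≡ (S₂ - S₁) * (S₄ - S₃) - ((S₃ - S₂) * (S₃ - S₂) + (S₃ - S₂) * (S₄ - S₃))
    diff = solve-∀
  symmetric⇒gaps (zero , suc (suc (suc zero)) , _ , copy) =
    drop₁≅drop₄ (sym (copy⇒gap-ratio s₁<s₂ s₂<s₃ s₂<s₃ s₃<s₄ copy))
  symmetric⇒gaps (suc zero , suc (suc zero) , _ , copy) =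
    ⊥-elim (≡⇒difference-≯0 (sym (copy⇒gap-ratio s₁<s₂ s₂<s₄ s₁<s₃ s₃<s₄ copy)) (diff S₁ S₂ S₃ S₄)
      (*-pos D₂>0 (+-pos (+-pos D₁>0 D₂>0) D₃>0)))
    where
    diff : ∀ S₁ S₂ S₃ S₄ → (S₄ - S₂) * (S₃ - S₁) - (S₂ - S₁) * (S₄ - S₃)
                         ≡ (S₃ - S₂) * ((S₂ - S₁) + (S₃ - S₂) + (S₄ - S₃))
    diff = solve-∀
  symmetric⇒gaps (suc zero , suc (suc (suc zero)) , _ , copy) =
    drop₂≅drop₄ (≡⇒difference-≡ (copy⇒gap-ratio s₁<s₂ s₂<s₃ s₁<s₃ s₃<s₄ copy) (diff S₁ S₂ S₃ S₄))
    where
    diff : ∀ S₁ S₂ S₃ S₄ → (S₂ - S₁) * (S₄ - S₃) - (S₃ - S₂) * (S₃ - S₁)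
                         ≡ (S₂ - S₁) * (S₄ - S₃) - ((S₂ - S₁) * (S₃ - S₂) + (S₃ - S₂) * (S₃ - S₂))
    diff = solve-∀
  symmetric⇒gaps (suc (suc zero) , suc (suc (suc zero)) , _ , copy) =
    ⊥-elim (≡⇒difference-≯0 (copy⇒gap-ratio s₁<s₂ s₂<s₃ s₁<s₂ s₂<s₄ copy) (diff S₁ S₂ S₃ S₄) (*-pos D₁>0 D₃>0))
    where
    diff : ∀ S₁ S₂ S₃ S₄ → (S₂ - S₁) * (S₄ - S₂) - (S₃ - S₂) * (S₂ - S₁) ≡ (S₂ - S₁) * (S₄ - S₃)
    diff = solve-∀
  symmetric⇒gaps (_ , zero , () , _)
  symmetric⇒gaps (suc _ , suc zero , s≤s () , _)
  symmetric⇒gaps (suc (suc _) , suc (suc zero) , s≤s (s≤s ()) , _)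
  symmetric⇒gaps (suc (suc (suc _)) , suc (suc (suc zero)) , s≤s (s≤s (s≤s ())) , _)

theorem4p1 : (s₁ s₂ s₃ s₄ : ℕ) → s₁ < s₂ → s₂ < s₃ → s₃ < s₄ →
    (HasStrategy 4 (toList (s₁ ∷ s₂ ∷ s₃ ∷ s₄ ∷ [])) ⇔ Symmetric (s₁ ∷ s₂ ∷ s₃ ∷ s₄ ∷ []))
theorem4p1 s₁ s₂ s₃ s₄ s₁<s₂ s₂<s₃ s₃<s₄ = mk⇔
  (makerWins⇒symmetric (s₁ ∷ s₂ ∷ s₃ ∷ s₄ ∷ []) (increasing₄ s₁<s₂ s₂<s₃ s₃<s₄))
  (Gaps.gaps⇒strategy s₁<s₂ s₂<s₃ s₃<s₄ ∘ symmetric⇒gaps s₁<s₂ s₂<s₃ s₃<s₄)
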